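{- For every integer $n\ge 1$, each of the sets $\mathcal{S}_n(1\text{ - }32,\,2\text{ - }13)$, $\mathcal{S}_n(3\text{ - }12,\,2\text{ - }31)$, $\mathcal{S}_n(13\text{ - }2,\,21\text{ - }3)$, $\mathcal{S}_n(23\text{ - }1,\,31\text{ - }2)$ has cardinality $2^{n-1}$.
   Context: A permutation of $[n]=\{1,\dots,n\}$ is written as a word $\pi=a_1a_2\cdots a_n$. For a permutation $xyz$ of $\{1,2,3\}$: $\pi$ contains the pattern $x\text{ - }yz$ if there are indices $1\le i<j<n$ such that $a_i,a_j,a_{j+1}$ are in the same relative order as $x,y,z$; $\pi$ contains the pattern $xy\text{ - }z$ if there are indices $i$ and $k$ with $i+1<k\le n$ such that $a_i,a_{i+1},a_k$ are in the same relative order as $x,y,z$. $\pi$ avoids a pattern if it does not contain it. $\mathcal{S}_n(p,q)$ is the set of permutations of $[n]$ avoiding both $p$ and $q$. -}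

module Defs where

open import Data.Nat using (ℕ; zero; suc; _<_; _≤_; _+_)
open import Data.Fin using (Fin; toℕ)
open import Data.Vec using (Vec; lookup)
open import Data.Product using (Σ; _×_; ∃; ∃-syntax)
open import Relation.Nullary using (¬_)
open import Relation.Binary.PropositionalEquality using (_≡_)
open import Function.Definitions using (Injective)
open import Data.List using (List; length)
open import Data.List.Relation.Unary.Unique.Propositional using (Unique)
open import Data.List.Membership.Propositional using (_∈_)

-- A permutation of [n] written as a word a₁…aₙ: a vector of length n with
-- entries in Fin n (value i stands for i+1), all entries distinct.
IsPerm : ∀ {n} → Vec (Fin n) n → Set
IsPerm {n} w = Injective _≡_ _≡_ (lookup w)

Perm : ℕ → Set
Perm n = Σ (Vec (Fin n) n) IsPerm

-- A pattern letter string xyz, a permutation of {1,2,3} given by three naturals.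
record Triple : Set where
  constructor ⟨_,_,_⟩
  field x y z : ℕ

SameOrder : ℕ → ℕ → ℕ → Triple → Set
SameOrder a b c ⟨ x , y , z ⟩ =
  (a < b → x < y) × (x < y → a < b) ×
  (a < c → x < z) × (x < z → a < c) ×
  (b < c → y < z) × (y < z → b < c) ×
  (b < a → y < x) × (y < x → b < a) ×
  (c < a → z < x) × (z < x → c < a) ×
  (c < b → z < y) × (z < y → c < b)

-- Dashed patterns of length 3.
--   first-dash xyz  is  x-yz ,   second-dash xyz  is  xy-z .
data Pattern : Set where
  first-dash  : Triple → Pattern
  second-dash : Triple → Pattern

val : ∀ {n} → Vec (Fin n) n → Fin n → ℕ
val w i = toℕ (lookup w i)

-- Positions are 0-based (i ↦ i+1 in the paper).
-- x-yz : i < j and j+1 < n (so positions i < j < j+1 all exist),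
--        (a_i, a_j, a_{j+1}) in the order of (x,y,z).
-- xy-z : i+1 < k (with k < n), (a_i, a_{i+1}, a_k) in the order of (x,y,z).
Contains : ∀ {n} → Pattern → Vec (Fin n) n → Set
Contains {n} (first-dash t) w =
  Σ (Fin n) λ i → Σ (Fin n) λ j → Σ (Fin n) λ j' →
    (toℕ i < toℕ j) × (toℕ j' ≡ suc (toℕ j)) ×
    SameOrder (val w i) (val w j) (val w j') t
Contains {n} (second-dash t) w =
  Σ (Fin n) λ i → Σ (Fin n) λ i' → Σ (Fin n) λ k →
    (toℕ i' ≡ suc (toℕ i)) × (suc (toℕ i) < toℕ k) ×
    SameOrder (val w i) (val w i') (val w k) t

Avoids : ∀ {n} → Pattern → Vec (Fin n) n → Set
Avoids p w = ¬ Contains p w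

InS : (n : ℕ) → Pattern → Pattern → Vec (Fin n) n → Set
InS n p q w = IsPerm w × Avoids p w × Avoids q w

-- "the set {w | P w} of words of length n has cardinality m":
-- there is a duplicate-free list of length m whose members are exactly the
-- words satisfying P.  (Counting the words themselves avoids proof-relevance
-- issues with Σ-types whose second component contains functions.)
HasCard : ∀ {n} → (Vec (Fin n) n → Set) → ℕ → Set
HasCard {n} P m =
  Σ (List (Vec (Fin n) n)) λ ws →
    Unique ws × length ws ≡ m × (∀ w → (w ∈ ws → P w) × (P w → w ∈ ws))

{-# OPTIONS --safe #-}
-- In a permutation, an occurrence of the classical pattern 132 or 213 can be slid to a
-- dashed one: walking between two of its positions, some pair of adjacent entries must
-- straddle the value of the third letter.  So S_n(1-32, 2-13) and S_n(13-2, 21-3) both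
-- equal S_n(132, 213).  A permutation c w avoids 132 and 213 iff the standardisation of
-- w does and c is either n or immediately followed by c + 1; hence S_n(132, 213) doubles
-- with each n.  The two remaining sets are the complements of the first two.
module Submission where

open import Defs
open import Data.Nat using (ℕ; zero; suc; _≤_; _<_; _∸_; _^_; _+_; z≤n; s≤s; s≤s⁻¹; z<s; s<s)
open import Data.Nat.Properties
open import Data.Product using (_×_; _,_; Σ; ∃-syntax; proj₁; proj₂; map₂; swap)
open import Data.Sum using (_⊎_; inj₁; inj₂)
import Data.Sum as Sum
open import Data.Empty using (⊥; ⊥-elim)
open import Relation.Nullary using (¬_; yes; no; contradiction)
open import Relation.Unary using (Decidable)
open import Relation.Binary.PropositionalEquality
  using (_≡_; _≢_; refl; sym; trans; cong; cong₂; subst; subst₂; module ≡-Reasoning)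
open import Relation.Binary.Definitions using (tri<; tri≈; tri>)
open import Function using (_∘_; id; _⇔_; mk⇔; Equivalence)
open import Function.Definitions using (Injective)
open import Data.Fin using (Fin; toℕ; fromℕ; fromℕ<; inject₁; punchIn; punchOut; opposite)
open import Data.Fin.Properties as Fin
  using (toℕ-injective; toℕ<n; toℕ-fromℕ; toℕ-fromℕ<; toℕ-inject₁; punchIn-injective;
         punchInᵢ≢i; punchOut-injective; punchIn-punchOut; any?; <⇒notInjective;
         opposite-prop; opposite-involutive)
open import Data.Vec using (Vec; []; _∷_; lookup; map; head)
open import Data.Vec.Properties
  using (lookup-map; map-∘; map-cong; map-id; ∷-injective; ∷-injectiveˡ)
import Data.List as List
open import Data.List using (List; _++_; [_]; length)
open import Data.List.Properties using (length-map; length-++)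
open import Data.List.Membership.Propositional using (_∈_)
open import Data.List.Membership.Propositional.Properties
  using (∈-map⁺; ∈-map⁻; ∈-++⁻; ∈-++⁺ˡ; ∈-++⁺ʳ)
open import Data.List.Relation.Unary.Any using (here)
import Data.List.Relation.Unary.All as All
import Data.List.Relation.Unary.AllPairs as AllPairs
open import Data.List.Relation.Unary.Unique.Propositional using (Unique)
open import Data.List.Relation.Unary.Unique.Propositional.Properties using (map⁺; ++⁺)

-- Classical and dashed occurrences in sequences

Shape : Set₁
Shape = ℕ → ℕ → ℕ → Set

Order132 Order213 : Shape
Order132 a b c = a < c × c < b
Order213 a b c = b < a × a < c

-- A sequence of length n is a function ℕ → ℕ of which only positions 0 … n-1 are read.
Occurs OccursFirstDash OccursSecondDash : Shape → ℕ → (ℕ → ℕ) → Set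
Occurs R n f =
  Σ ℕ λ i → Σ ℕ λ j → Σ ℕ λ k → i < j × j < k × k < n × R (f i) (f j) (f k)
OccursFirstDash R n f =
  Σ ℕ λ i → Σ ℕ λ j → i < j × suc j < n × R (f i) (f j) (f (suc j))
OccursSecondDash R n f =
  Σ ℕ λ i → Σ ℕ λ k → suc i < k × k < n × R (f i) (f (suc i)) (f k)

Avoids132-213 : ℕ → (ℕ → ℕ) → Set
Avoids132-213 n f = ¬ Occurs Order132 n f × ¬ Occurs Order213 n f

InjectiveBelow : ℕ → (ℕ → ℕ) → Set
InjectiveBelow n f = ∀ {p q} → p < n → q < n → f p ≡ f q → p ≡ q

Comparative : Shape → Set
Comparative R = ∀ {a b c a' b' c'} →
  (a < b → a' < b') → (b < a → b' < a') → (a < c → a' < c') →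
  (c < a → c' < a') → (b < c → b' < c') → (c < b → c' < b') →
  R a b c → R a' b' c'

order132-comparative : Comparative Order132
order132-comparative _ _ ac _ _ cb (a<c , c<b) = ac a<c , cb c<b

order213-comparative : Comparative Order213
order213-comparative _ ba ac _ _ _ (b<a , a<c) = ba b<a , ac a<c

¬order132-adjacent : ∀ {a c} → ¬ Order132 a (suc a) c
¬order132-adjacent (a<c , c<1+a) = <⇒≱ a<c (s≤s⁻¹ c<1+a)

¬order213-adjacent : ∀ {a c} → ¬ Order213 a (suc a) c
¬order213-adjacent (1+a<a , _) = <-asym (n<1+n _) 1+a<a

Occurs-transport : ∀ {R n f f'} → Comparative R →
                   (∀ {p q} → p < n → q < n → f p < f q → f' p < f' q) →
                   Occurs R n f → Occurs R n f'
Occurs-transport R-cmp mono (i , j , k , i<j , j<k , k<n , r) =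
  i , j , k , i<j , j<k , k<n ,
  R-cmp (mono i<n j<n) (mono j<n i<n) (mono i<n k<n) (mono k<n i<n) (mono j<n k<n) (mono k<n j<n) r
  where
    j<n = <-trans j<k k<n
    i<n = <-trans i<j j<n

firstDash⇒occurs : ∀ {R n f} → OccursFirstDash R n f → Occurs R n f
firstDash⇒occurs (i , j , i<j , 1+j<n , r) = i , j , suc j , i<j , n<1+n j , 1+j<n , r

secondDash⇒occurs : ∀ {R n f} → OccursSecondDash R n f → Occurs R n f
secondDash⇒occurs (i , k , 1+i<k , k<n , r) = i , suc i , k , n<1+n i , 1+i<k , k<n , r

crossing : ∀ {Q : ℕ → Set} → Decidable Q → ∀ {j k} → j ≤ k → Q j → ¬ Q k →
           ∃[ m ] j ≤ m × m < k × Q m × ¬ Q (suc m)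
crossing Q? {k = zero} z≤n qj ¬qk = contradiction qj ¬qk
crossing Q? {k = suc k} j≤1+k qj ¬q1+k with m≤n⇒m<n∨m≡n j≤1+k
... | inj₂ refl = contradiction qj ¬q1+k
... | inj₁ j<1+k with Q? k
...   | yes qk = k , s≤s⁻¹ j<1+k , n<1+n k , qk , ¬q1+k
...   | no ¬qk =
  let m , j≤m , m<k , qm , ¬q1+m = crossing Q? (s≤s⁻¹ j<1+k) qj ¬qk
  in  m , j≤m , m<n⇒m<1+n m<k , qm , ¬q1+m

module _ {n f} (f-inj : InjectiveBelow n f) where

  private
    ≮⇒> : ∀ {p q} → p < n → q < n → p ≢ q → ¬ f p < f q → f q < f p
    ≮⇒> p<n q<n p≢q fp≮fq = ≤∧≢⇒< (≮⇒≥ fp≮fq) (p≢q ∘ f-inj p<n q<n ∘ sym)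

  occurs213⇒firstDash : Occurs Order213 n f → OccursFirstDash Order213 n f
  occurs213⇒firstDash (i , j , k , i<j , j<k , k<n , fj<fi , fi<fk) =
    let m , j≤m , m<k , fm<fi , f1+m≮fi =
          crossing (λ p → f p <? f i) (<⇒≤ j<k) fj<fi (<-asym fi<fk)
        i<m = <-≤-trans i<j j≤m
        1+m<n = ≤-<-trans m<k k<n
    in  i , m , i<m , 1+m<n , fm<fi ,
        ≮⇒> 1+m<n (<-trans i<j (<-trans j<k k<n)) (>⇒≢ (m<n⇒m<1+n i<m)) f1+m≮fi

  occurs132⇒firstDash : Occurs Order132 n f →
                        OccursFirstDash Order132 n f ⊎ OccursFirstDash Order213 n f
  occurs132⇒firstDash (i , j , k , i<j , j<k , k<n , fi<fk , fk<fj)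
    with m , j≤m , m<k , fk<fm , fk≮f1+m
           ← crossing (λ m → f k <? f m) (<⇒≤ j<k) fk<fj (<-irrefl refl)
    with f i <? f (suc m)
  ... | yes fi<f1+m =
    inj₁ (i , m , <-≤-trans i<j j≤m , ≤-<-trans m<k k<n , fi<f1+m , ≤-<-trans (≮⇒≥ fk≮f1+m) fk<fm)
  ... | no fi≮f1+m =
    inj₂ (occurs213⇒firstDash (i , suc m , k , i<1+m , 1+m<k , k<n , f1+m<fi , fi<fk))
    where
      i<1+m = m<n⇒m<1+n (<-≤-trans i<j j≤m)
      f1+m<fi = ≮⇒> (<-trans i<j (<-trans j<k k<n)) (≤-<-trans m<k k<n) (<⇒≢ i<1+m) fi≮f1+m
      1+m<k = ≤∧≢⇒< m<k (λ 1+m≡k → <-asym fi<fk (subst (λ q → f q < f i) 1+m≡k f1+m<fi))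

  occurs132⇒secondDash : Occurs Order132 n f → OccursSecondDash Order132 n f
  occurs132⇒secondDash (i , j , k , i<j , j<k , k<n , fi<fk , fk<fj) =
    let m , i≤m , m<j , fm<fk , f1+m≮fk =
          crossing (λ p → f p <? f k) (<⇒≤ i<j) fi<fk (<-asym fk<fj)
        1+m<k = ≤-<-trans m<j j<k
    in  m , k , 1+m<k , k<n , fm<fk , ≮⇒> (<-trans 1+m<k k<n) k<n (<⇒≢ 1+m<k) f1+m≮fk

  occurs213⇒secondDash : Occurs Order213 n f →
                         OccursSecondDash Order132 n f ⊎ OccursSecondDash Order213 n f
  occurs213⇒secondDash (i , j , k , i<j , j<k , k<n , fj<fi , fi<fk)
    with m , i≤m , m<j , fj<fm , fj≮f1+m
           ← crossing (λ m → f j <? f m) (<⇒≤ i<j) fj<fi (<-irrefl refl)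
    with f m <? f k
  ... | yes fm<fk =
    inj₂ (m , k , ≤-<-trans m<j j<k , k<n , ≤-<-trans (≮⇒≥ fj≮f1+m) fj<fm , fm<fk)
  ... | no fm≮fk =
    inj₁ (occurs132⇒secondDash (i , m , k , i<m , <-trans m<j j<k , k<n , fi<fk , fk<fm))
    where
      m<n = <-trans m<j (<-trans j<k k<n)
      fk<fm = ≮⇒> m<n k<n (<⇒≢ (<-trans m<j j<k)) fm≮fk
      i<m = ≤∧≢⇒< i≤m (λ i≡m → <-asym fi<fk (subst (λ q → f k < f q) (sym i≡m) fk<fm))

-- Prepending an entry

OccursAtHead : Shape → ℕ → (ℕ → ℕ) → Set
OccursAtHead R n f = Σ ℕ λ j → Σ ℕ λ k → 0 < j × j < k × k < n × R (f 0) (f j) (f k)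

Occurs-uncons : ∀ {R n f} → Occurs R (suc n) f → OccursAtHead R (suc n) f ⊎ Occurs R n (f ∘ suc)
Occurs-uncons (zero  , j     , k     , 0<j     , j<k     , k<1+n   , r) =
  inj₁ (j , k , 0<j , j<k , k<1+n , r)
Occurs-uncons (suc i , suc j , suc k , s<s i<j , s<s j<k , s<s k<n , r) =
  inj₂ (i , j , k , i<j , j<k , k<n , r)

Occurs-cons : ∀ {R n f} → Occurs R n (f ∘ suc) → Occurs R (suc n) f
Occurs-cons (i , j , k , i<j , j<k , k<n , r) =
  suc i , suc j , suc k , s<s i<j , s<s j<k , s<s k<n , r

¬occursAtHead-max : ∀ {R n f} → (∀ {a b c} → R a b c → a < c) →
                    (∀ {k} → 0 < k → k < n → f k < f 0) → ¬ OccursAtHead R n f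
¬occursAtHead-max R⇒a<c below-head (j , k , 0<j , j<k , k<n , r) =
  <-asym (R⇒a<c r) (below-head (<-trans 0<j j<k) k<n)

-- Since f 0 and f 1 are adjacent values, every other entry compares with them alike.
occursAtHead-adjacent : ∀ {R n f} → Comparative R → (∀ {a c} → ¬ R a (suc a) c) →
                        InjectiveBelow (suc n) f → f 1 ≡ suc (f 0) →
                        OccursAtHead R (suc n) f → Occurs R n (f ∘ suc)
occursAtHead-adjacent {R} {f = f} R-cmp R-adj f-inj f1≡ (suc zero , k , _ , _ , _ , r) =
  contradiction (subst (λ b → R (f 0) b (f k)) f1≡ r) R-adj
occursAtHead-adjacent {n = n} {f} R-cmp R-adj f-inj f1≡
                      (suc (suc j) , suc k , _ , s<s 1+j<k , s<s k<n , r) =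
  0 , suc j , k , z<s , 1+j<k , k<n ,
  R-cmp (above (s<s z<s) (s<s (<-trans 1+j<k k<n))) below
        (above (s<s (<-trans z<s 1+j<k)) (s<s k<n)) below id id r
  where
    above : ∀ {p} → 1 < p → p < suc n → f 0 < f p → f 1 < f p
    above {p} 1<p p<1+n f0<fp =
      ≤∧≢⇒< (subst (_≤ f p) (sym f1≡) f0<fp) (<⇒≢ 1<p ∘ f-inj (<-trans 1<p p<1+n) p<1+n)
    below : ∀ {p} → f p < f 0 → f p < f 1
    below {p} fp<f0 = subst (f p <_) (sym f1≡) (m<n⇒m<1+n fp<f0)

punchInℕ : ℕ → ℕ → ℕ
punchInℕ zero    x       = suc x
punchInℕ (suc c) zero    = zero
punchInℕ (suc c) (suc x) = suc (punchInℕ c x)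

punchInℕ-mono-< : ∀ c {x y} → x < y → punchInℕ c x < punchInℕ c y
punchInℕ-mono-< zero    x<y                   = s<s x<y
punchInℕ-mono-< (suc c) {zero}  {suc y} _     = z<s
punchInℕ-mono-< (suc c) {suc x} {suc y} (s<s x<y) = s<s (punchInℕ-mono-< c x<y)

punchInℕ-cancel-< : ∀ c {x y} → punchInℕ c x < punchInℕ c y → x < y
punchInℕ-cancel-< c {x} {y} lt with <-cmp x y
... | tri< x<y _ _ = x<y
... | tri≈ _ refl _ = contradiction lt (<-irrefl refl)
... | tri> _ _ y<x = contradiction (punchInℕ-mono-< c y<x) (<-asym lt)

punchInℕ-< : ∀ {c x} → x < c → punchInℕ c x ≡ x
punchInℕ-< {suc c} {zero}  _         = refl
punchInℕ-< {suc c} {suc x} (s<s x<c) = cong suc (punchInℕ-< x<c)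

punchInℕ-≥ : ∀ {c x} → c ≤ x → punchInℕ c x ≡ suc x
punchInℕ-≥ {zero}  _         = refl
punchInℕ-≥ {suc c} (s≤s c≤x) = cong suc (punchInℕ-≥ c≤x)

module Prepend {n : ℕ} {h g : ℕ → ℕ} {c : ℕ}
               (g-head : g 0 ≡ c) (g-tail : ∀ {p} → p < suc n → g (suc p) ≡ punchInℕ c (h p)) where

  occurs-tail⇔ : ∀ {R} → Comparative R → Occurs R (suc n) h ⇔ Occurs R (suc n) (g ∘ suc)
  occurs-tail⇔ R-cmp = mk⇔ (Occurs-transport R-cmp mono) (Occurs-transport R-cmp cancel)
    where
      mono : ∀ {p q} → p < suc n → q < suc n → h p < h q → g (suc p) < g (suc q)
      mono p<1+n q<1+n = subst₂ _<_ (sym (g-tail p<1+n)) (sym (g-tail q<1+n)) ∘ punchInℕ-mono-< c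
      cancel : ∀ {p q} → p < suc n → q < suc n → g (suc p) < g (suc q) → h p < h q
      cancel p<1+n q<1+n = punchInℕ-cancel-< c ∘ subst₂ _<_ (g-tail p<1+n) (g-tail q<1+n)

  ¬occurs-prepend : ∀ {R} → Comparative R → (∀ {a b c} → R a b c → a < c) →
                    (∀ {a c} → ¬ R a (suc a) c) →
                    InjectiveBelow (suc (suc n)) g → (∀ {p} → p < suc n → h p < suc n) →
                    c ≡ suc n ⊎ c ≡ h 0 → ¬ Occurs R (suc n) h → ¬ Occurs R (suc (suc n)) g
  ¬occurs-prepend {R} R-cmp R⇒a<c R-adj g-inj h<1+n max-or-head ¬occ occ
    with Occurs-uncons {R} {f = g} occ | max-or-head
  ... | inj₂ tail | _         = ¬occ (Equivalence.from (occurs-tail⇔ R-cmp) tail)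
  ... | inj₁ head | inj₁ refl = ¬occursAtHead-max {R} {f = g} R⇒a<c below-head head
    where
      below-head : ∀ {k} → 0 < k → k < suc (suc n) → g k < g 0
      below-head {suc k} _ (s<s k<1+n) =
        subst₂ _<_ (sym (trans (g-tail k<1+n) (punchInℕ-< (h<1+n k<1+n)))) (sym g-head)
                   (h<1+n k<1+n)
  ... | inj₁ head | inj₂ refl =
    ¬occ (Equivalence.from (occurs-tail⇔ R-cmp)
                           (occursAtHead-adjacent {R} {f = g} R-cmp R-adj g-inj g1≡1+g0 head))
    where
      g1≡1+g0 : g 1 ≡ suc (g 0)
      g1≡1+g0 = trans (g-tail z<s) (trans (punchInℕ-≥ ≤-refl) (cong suc (sym g-head)))

  avoids-tail : Avoids132-213 (suc (suc n)) g → Avoids132-213 (suc n) h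
  avoids-tail (¬132 , ¬213) =
    ¬132 ∘ Occurs-cons {Order132} {f = g} ∘ Equivalence.to (occurs-tail⇔ order132-comparative) ,
    ¬213 ∘ Occurs-cons {Order213} {f = g} ∘ Equivalence.to (occurs-tail⇔ order213-comparative)

  private
    g≡1+c : ∀ {p} → p < suc n → h p ≡ c → g (suc p) ≡ suc c
    g≡1+c p<1+n hp≡c = trans (g-tail p<1+n) (trans (cong (punchInℕ c) hp≡c) (punchInℕ-≥ ≤-refl))

  -- If c is neither the maximum nor h 0, then the entry c + 1 of g comes after g 1 and
  -- completes a 132 or a 213 with g 0 = c and g 1.
  max-or-head : c ≤ suc n → (∀ {v} → v < suc n → ∃[ p ] p < suc n × h p ≡ v) →
                Avoids132-213 (suc (suc n)) g → c ≡ suc n ⊎ c ≡ h 0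
  max-or-head c≤1+n h-onto (¬132 , ¬213) with m≤n⇒m<n∨m≡n c≤1+n
  ... | inj₂ c≡1+n = inj₁ c≡1+n
  ... | inj₁ c<1+n with h-onto c<1+n
  ...   | zero , _ , h0≡c = inj₂ (sym h0≡c)
  ...   | suc p , 1+p<1+n , h1+p≡c with <-cmp c (h 0) | g≡1+c 1+p<1+n h1+p≡c
  ...     | tri≈ _ c≡h0 _ | _ = inj₂ c≡h0
  ...     | tri< c<h0 _ _ | g2+p≡1+c =
    contradiction (0 , 1 , suc (suc p) , z<s , s<s z<s , s<s 1+p<1+n ,
                   subst₂ _<_ (sym g-head) (sym g2+p≡1+c) (n<1+n c) ,
                   subst₂ _<_ (sym g2+p≡1+c) (sym (trans (g-tail z<s) (punchInℕ-≥ (<⇒≤ c<h0))))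
                              (s<s c<h0)) ¬132
  ...     | tri> _ _ h0<c | g2+p≡1+c =
    contradiction (0 , 1 , suc (suc p) , z<s , s<s z<s , s<s 1+p<1+n ,
                   subst₂ _<_ (sym (trans (g-tail z<s) (punchInℕ-< h0<c))) (sym g-head) h0<c ,
                   subst₂ _<_ (sym g-head) (sym g2+p≡1+c) (n<1+n c)) ¬213

-- Words as sequences

-- Positions beyond the length of the word read as 0.
seq : ∀ {m k} → Vec (Fin m) k → ℕ → ℕ
seq []       _       = 0
seq (x ∷ xs) zero    = toℕ x
seq (x ∷ xs) (suc p) = seq xs p

seq-toℕ : ∀ {m k} (w : Vec (Fin m) k) (i : Fin k) → seq w (toℕ i) ≡ toℕ (lookup w i)
seq-toℕ (x ∷ xs) Fin.zero    = refl
seq-toℕ (x ∷ xs) (Fin.suc i) = seq-toℕ xs i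

seq-fromℕ< : ∀ {m k} (w : Vec (Fin m) k) {p} (p<k : p < k) → seq w p ≡ toℕ (lookup w (fromℕ< p<k))
seq-fromℕ< w p<k = trans (cong (seq w) (sym (toℕ-fromℕ< p<k))) (seq-toℕ w _)

seq-< : ∀ {m k} (w : Vec (Fin m) k) {p} → p < k → seq w p < m
seq-< w p<k = subst (_< _) (sym (seq-fromℕ< w p<k)) (toℕ<n _)

seq-map : ∀ {m m' k} {f : Fin m → Fin m'} {φ : ℕ → ℕ} → (∀ x → toℕ (f x) ≡ φ (toℕ x)) →
          (w : Vec (Fin m) k) → ∀ {p} → p < k → seq (map f w) p ≡ φ (seq w p)
seq-map f≗φ (x ∷ xs) {zero}  _         = f≗φ x
seq-map {φ = φ} f≗φ (x ∷ xs) {suc p} (s<s p<k) = seq-map {φ = φ} f≗φ xs p<k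

IsPerm⇒injectiveBelow : ∀ {k} (w : Vec (Fin k) k) → IsPerm w → InjectiveBelow k (seq w)
IsPerm⇒injectiveBelow w perm {p} {q} p<k q<k e = begin
  p                  ≡⟨ toℕ-fromℕ< p<k ⟨
  toℕ (fromℕ< p<k)   ≡⟨ cong toℕ (perm (toℕ-injective lookups≡)) ⟩
  toℕ (fromℕ< q<k)   ≡⟨ toℕ-fromℕ< q<k ⟩
  q                  ∎
  where
    open ≡-Reasoning
    lookups≡ = trans (sym (seq-fromℕ< w p<k)) (trans e (seq-fromℕ< w q<k))

injective⇒surjective : ∀ {n} {f : Fin n → Fin n} → Injective _≡_ _≡_ f → ∀ v → ∃[ i ] f i ≡ v
injective⇒surjective {suc n} {f} f-inj v with any? (λ i → f i Fin.≟ v)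
... | yes hit = hit
... | no miss = ⊥-elim (<⇒notInjective (n<1+n n) f∖v-injective)
  where
    v≢f : ∀ i → v ≢ f i
    v≢f i = miss ∘ (i ,_) ∘ sym
    f∖v : Fin (suc n) → Fin n
    f∖v i = punchOut (v≢f i)
    f∖v-injective : Injective _≡_ _≡_ f∖v
    f∖v-injective {i} {j} = f-inj ∘ punchOut-injective (v≢f i) (v≢f j)

IsPerm⇒seq-onto : ∀ {k} (w : Vec (Fin k) k) → IsPerm w → ∀ {v} → v < k → ∃[ p ] p < k × seq w p ≡ v
IsPerm⇒seq-onto w perm v<k =
  let i , wᵢ≡v = injective⇒surjective perm (fromℕ< v<k)
  in  toℕ i , toℕ<n i , trans (seq-toℕ w i) (trans (cong toℕ wᵢ≡v) (toℕ-fromℕ< v<k))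

Av132-213 : ∀ {k} → Vec (Fin k) k → Set
Av132-213 {k} w = IsPerm w × Avoids132-213 k (seq w)

private
  never : ∀ {A : Set} {u v} → u < v → v < u → A
  never u<v = ⊥-elim ∘ <-asym u<v

sameOrder⇔order132 : ∀ {a b c x y z} → x < z → z < y →
                     SameOrder a b c ⟨ x , y , z ⟩ ⇔ Order132 a b c
sameOrder⇔order132 x<z z<y = mk⇔
  (λ (_ , _ , _ , xz , _ , _ , _ , _ , _ , _ , _ , zy) → xz x<z , zy z<y)
  (λ (a<c , c<b) → let a<b = <-trans a<c c<b; x<y = <-trans x<z z<y in
    (λ _ → x<y) , (λ _ → a<b) , (λ _ → x<z) , (λ _ → a<c) , never c<b , never z<y ,
    never a<b , never x<y , never a<c , never x<z , (λ _ → z<y) , (λ _ → c<b))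

sameOrder⇔order213 : ∀ {a b c x y z} → y < x → x < z →
                     SameOrder a b c ⟨ x , y , z ⟩ ⇔ Order213 a b c
sameOrder⇔order213 y<x x<z = mk⇔
  (λ (_ , _ , _ , xz , _ , _ , _ , yx , _ , _ , _ , _) → yx y<x , xz x<z)
  (λ (b<a , a<c) → let b<c = <-trans b<a a<c; y<z = <-trans y<x x<z in
    never b<a , never y<x , (λ _ → x<z) , (λ _ → a<c) , (λ _ → y<z) , (λ _ → b<c) ,
    (λ _ → y<x) , (λ _ → b<a) , never a<c , never x<z , never b<c , never y<z)

module _ {k} (w : Vec (Fin k) k) {t : Triple} {R : Shape}
         (t⇔R : ∀ {a b c} → SameOrder a b c t ⇔ R a b c) where

  private
    R-subst : ∀ {a b c a' b' c'} → a ≡ a' → b ≡ b' → c ≡ c' → R a b c → R a' b' c'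
    R-subst refl refl refl r = r

  contains-firstDash⇔ : Contains (first-dash t) w ⇔ OccursFirstDash R k (seq w)
  contains-firstDash⇔ = mk⇔
    (λ (i , j , j' , i<j , j'≡1+j , so) →
       toℕ i , toℕ j , i<j , subst (_< k) j'≡1+j (toℕ<n j') ,
       R-subst (sym (seq-toℕ w i)) (sym (seq-toℕ w j))
               (trans (sym (seq-toℕ w j')) (cong (seq w) j'≡1+j)) (Equivalence.to t⇔R so))
    (λ (p , q , p<q , 1+q<k , r) →
       let q<k = <-trans (n<1+n q) 1+q<k; p<k = <-trans p<q q<k in
       fromℕ< p<k , fromℕ< q<k , fromℕ< 1+q<k ,
       subst₂ _<_ (sym (toℕ-fromℕ< p<k)) (sym (toℕ-fromℕ< q<k)) p<q ,
       trans (toℕ-fromℕ< 1+q<k) (cong suc (sym (toℕ-fromℕ< q<k))) ,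
       Equivalence.from t⇔R (R-subst (seq-fromℕ< w p<k) (seq-fromℕ< w q<k) (seq-fromℕ< w 1+q<k) r))

  contains-secondDash⇔ : Contains (second-dash t) w ⇔ OccursSecondDash R k (seq w)
  contains-secondDash⇔ = mk⇔
    (λ (i , i' , m , i'≡1+i , 1+i<m , so) →
       toℕ i , toℕ m , 1+i<m , toℕ<n m ,
       R-subst (sym (seq-toℕ w i)) (trans (sym (seq-toℕ w i')) (cong (seq w) i'≡1+i))
               (sym (seq-toℕ w m)) (Equivalence.to t⇔R so))
    (λ (p , m , 1+p<m , m<k , r) →
       let 1+p<k = <-trans 1+p<m m<k; p<k = <-trans (n<1+n p) 1+p<k in
       fromℕ< p<k , fromℕ< 1+p<k , fromℕ< m<k ,
       trans (toℕ-fromℕ< 1+p<k) (cong suc (sym (toℕ-fromℕ< p<k))) ,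
       subst₂ _<_ (cong suc (sym (toℕ-fromℕ< p<k))) (sym (toℕ-fromℕ< m<k)) 1+p<m ,
       Equivalence.from t⇔R (R-subst (seq-fromℕ< w p<k) (seq-fromℕ< w 1+p<k) (seq-fromℕ< w m<k) r))

module _ {k} (w : Vec (Fin k) k) where

  private
    1<2 : 1 < 2
    1<2 = s<s z<s
    2<3 : 2 < 3
    2<3 = s<s 1<2
    1-32⇔ = contains-firstDash⇔  w (sameOrder⇔order132 1<2 2<3)
    2-13⇔ = contains-firstDash⇔  w (sameOrder⇔order213 1<2 2<3)
    13-2⇔ = contains-secondDash⇔ w (sameOrder⇔order132 1<2 2<3)
    21-3⇔ = contains-secondDash⇔ w (sameOrder⇔order213 1<2 2<3)

  Av132-213⇔avoidsFirstDash :
    Av132-213 w ⇔ InS k (first-dash ⟨ 1 , 3 , 2 ⟩) (first-dash ⟨ 2 , 1 , 3 ⟩) w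
  Av132-213⇔avoidsFirstDash = mk⇔
    (λ (perm , ¬132 , ¬213) →
       perm ,
       ¬132 ∘ firstDash⇒occurs {Order132} ∘ Equivalence.to 1-32⇔ ,
       ¬213 ∘ firstDash⇒occurs {Order213} ∘ Equivalence.to 2-13⇔)
    (λ (perm , ¬1-32 , ¬2-13) →
       let inj = IsPerm⇒injectiveBelow w perm in
       perm ,
       Sum.[ ¬1-32 ∘ Equivalence.from 1-32⇔ , ¬2-13 ∘ Equivalence.from 2-13⇔ ]
         ∘ occurs132⇒firstDash inj ,
       ¬2-13 ∘ Equivalence.from 2-13⇔ ∘ occurs213⇒firstDash inj)

  Av132-213⇔avoidsSecondDash :
    Av132-213 w ⇔ InS k (second-dash ⟨ 1 , 3 , 2 ⟩) (second-dash ⟨ 2 , 1 , 3 ⟩) w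
  Av132-213⇔avoidsSecondDash = mk⇔
    (λ (perm , ¬132 , ¬213) →
       perm ,
       ¬132 ∘ secondDash⇒occurs {Order132} ∘ Equivalence.to 13-2⇔ ,
       ¬213 ∘ secondDash⇒occurs {Order213} ∘ Equivalence.to 21-3⇔)
    (λ (perm , ¬13-2 , ¬21-3) →
       let inj = IsPerm⇒injectiveBelow w perm in
       perm ,
       ¬13-2 ∘ Equivalence.from 13-2⇔ ∘ occurs132⇒secondDash inj ,
       Sum.[ ¬13-2 ∘ Equivalence.from 13-2⇔ , ¬21-3 ∘ Equivalence.from 21-3⇔ ]
         ∘ occurs213⇒secondDash inj)

-- Counting S_n(132, 213)

toℕ-punchIn : ∀ {m} (i : Fin (suc m)) (j : Fin m) →
              toℕ (punchIn i j) ≡ punchInℕ (toℕ i) (toℕ j)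
toℕ-punchIn Fin.zero    j           = refl
toℕ-punchIn (Fin.suc i) Fin.zero    = refl
toℕ-punchIn (Fin.suc i) (Fin.suc j) = cong suc (toℕ-punchIn i j)

prepend : ∀ {m k} → Fin (suc m) → Vec (Fin m) k → Vec (Fin (suc m)) (suc k)
prepend c u = c ∷ map (punchIn c) u

module _ {n} (c : Fin (suc n)) {u : Vec (Fin n) n} where

  private
    lookup-prepend : ∀ i → lookup (prepend c u) (Fin.suc i) ≡ punchIn c (lookup u i)
    lookup-prepend i = lookup-map i (punchIn c) u

  IsPerm-prepend : IsPerm u → IsPerm (prepend c u)
  IsPerm-prepend perm {Fin.zero}  {Fin.zero}  _ = refl
  IsPerm-prepend perm {Fin.zero}  {Fin.suc j} e =
    contradiction (sym (trans e (lookup-prepend j))) (punchInᵢ≢i c _)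
  IsPerm-prepend perm {Fin.suc i} {Fin.zero}  e =
    contradiction (trans (sym (lookup-prepend i)) e) (punchInᵢ≢i c _)
  IsPerm-prepend perm {Fin.suc i} {Fin.suc j} e = cong Fin.suc (perm (punchIn-injective c _ _
    (trans (sym (lookup-prepend i)) (trans e (lookup-prepend j)))))

  IsPerm-prepend⁻ : IsPerm (prepend c u) → IsPerm u
  IsPerm-prepend⁻ perm {i} {j} e =
    Fin.suc-injective (perm (trans (lookup-prepend i)
                                   (trans (cong (punchIn c) e) (sym (lookup-prepend j)))))

toℕ≡n⇔≡fromℕ : ∀ {n} (c : Fin (suc n)) → toℕ c ≡ n ⇔ c ≡ fromℕ n
toℕ≡n⇔≡fromℕ c = mk⇔ (λ c≡n → toℕ-injective (trans c≡n (sym (toℕ-fromℕ _))))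
                     (λ { refl → toℕ-fromℕ _ })

toℕ≡seq-head⇔ : ∀ {m k} (c : Fin (suc m)) (u : Vec (Fin m) (suc k)) →
                toℕ c ≡ seq u 0 ⇔ c ≡ inject₁ (head u)
toℕ≡seq-head⇔ c (x ∷ _) = mk⇔ (λ c≡x → toℕ-injective (trans c≡x (sym (toℕ-inject₁ x))))
                              (λ { refl → toℕ-inject₁ x })

module _ {n} (c : Fin (suc (suc n))) (u : Vec (Fin (suc n)) (suc n)) where

  private
    open Prepend {n} {seq u} {seq (prepend c u)} {toℕ c}
                 refl (seq-map {φ = punchInℕ (toℕ c)} (toℕ-punchIn c) u)
    max⇔ = toℕ≡n⇔≡fromℕ c
    head⇔ = toℕ≡seq-head⇔ c u

  Av132-213-prepend⇔ :
    Av132-213 (prepend c u) ⇔ (Av132-213 u × (c ≡ fromℕ (suc n) ⊎ c ≡ inject₁ (head u)))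
  Av132-213-prepend⇔ = mk⇔
    (λ (perm , avoids) →
       (IsPerm-prepend⁻ c {u} perm , avoids-tail avoids) ,
       Sum.map (Equivalence.to max⇔) (Equivalence.to head⇔)
               (max-or-head (s≤s⁻¹ (toℕ<n c)) (IsPerm⇒seq-onto u (IsPerm-prepend⁻ c {u} perm))
                            avoids))
    (λ ((perm , ¬132 , ¬213) , max-or-head) →
       let g-inj = IsPerm⇒injectiveBelow (prepend c u) (IsPerm-prepend c {u} perm)
           max-or-headℕ = Sum.map (Equivalence.from max⇔) (Equivalence.from head⇔) max-or-head
       in  IsPerm-prepend c {u} perm ,
           ¬occurs-prepend order132-comparative proj₁ ¬order132-adjacent
                           g-inj (seq-< u) max-or-headℕ ¬132 ,
           ¬occurs-prepend order213-comparative proj₂ ¬order213-adjacent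
                           g-inj (seq-< u) max-or-headℕ ¬213)

prependMax prependHead : ∀ {n} → Vec (Fin (suc n)) (suc n) → Vec (Fin (suc (suc n))) (suc (suc n))
prependMax  u = prepend (fromℕ _) u
prependHead u = prepend (inject₁ (head u)) u

av132-213 : (n : ℕ) → List (Vec (Fin (suc n)) (suc n))
av132-213 zero    = [ Fin.zero ∷ [] ]
av132-213 (suc n) = List.map prependMax (av132-213 n) ++ List.map prependHead (av132-213 n)

Av132-213-singleton : Av132-213 (Fin.zero ∷ [])
Av132-213-singleton = (λ { {Fin.zero} {Fin.zero} _ → refl }) , ¬occurs₁ Order132 , ¬occurs₁ Order213
  where
    ¬occurs₁ : ∀ R {f} → ¬ Occurs R 1 f
    ¬occurs₁ _ (_ , _ , _ , _ , () , z<s , _)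

av132-213-sound : ∀ n {w} → w ∈ av132-213 n → Av132-213 w
av132-213-sound zero    (here refl) = Av132-213-singleton
av132-213-sound (suc n) w∈ with ∈-++⁻ (List.map prependMax (av132-213 n)) w∈
... | inj₁ w∈max with u , u∈ , refl ← ∈-map⁻ prependMax w∈max =
  Equivalence.from (Av132-213-prepend⇔ _ u) (av132-213-sound n u∈ , inj₁ refl)
... | inj₂ w∈head with u , u∈ , refl ← ∈-map⁻ prependHead w∈head =
  Equivalence.from (Av132-213-prepend⇔ _ u) (av132-213-sound n u∈ , inj₂ refl)

map-punchIn-onto : ∀ {m k} (c : Fin (suc m)) (xs : Vec (Fin (suc m)) k) →
                   (∀ i → c ≢ lookup xs i) → ∃[ ys ] map (punchIn c) ys ≡ xs
map-punchIn-onto c []       _   = [] , refl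
map-punchIn-onto c (x ∷ xs) c∉ =
  let ys , eq = map-punchIn-onto c xs (c∉ ∘ Fin.suc)
  in  punchOut (c∉ Fin.zero) ∷ ys , cong₂ _∷_ (punchIn-punchOut (c∉ Fin.zero)) eq

av132-213-complete : ∀ n {w} → Av132-213 w → w ∈ av132-213 n
av132-213-complete zero    {Fin.zero ∷ []} _ = here refl
av132-213-complete (suc n) {c ∷ w} av
  with u , refl ← map-punchIn-onto c w (λ i → Fin.0≢1+n ∘ proj₁ av)
  with Equivalence.to (Av132-213-prepend⇔ c u) av
... | av-u , inj₁ refl = ∈-++⁺ˡ (∈-map⁺ prependMax (av132-213-complete n av-u))
... | av-u , inj₂ refl =
  ∈-++⁺ʳ (List.map prependMax (av132-213 n)) (∈-map⁺ prependHead (av132-213-complete n av-u))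

map-injective : ∀ {A B : Set} {f : A → B} → (∀ {x y} → f x ≡ f y → x ≡ y) →
                ∀ {k} {xs ys : Vec A k} → map f xs ≡ map f ys → xs ≡ ys
map-injective f-inj {xs = []}     {[]}     _  = refl
map-injective f-inj {xs = x ∷ xs} {y ∷ ys} eq =
  let x≡y , xs≡ys = ∷-injective eq in cong₂ _∷_ (f-inj x≡y) (map-injective f-inj xs≡ys)

prepend-injective : ∀ {m k} {c c' : Fin (suc m)} {u u' : Vec (Fin m) k} →
                    prepend c u ≡ prepend c' u' → u ≡ u'
prepend-injective {c = c} eq with refl , tails ← ∷-injective eq =
  map-injective (punchIn-injective c _ _) tails

av132-213-unique : ∀ n → Unique (av132-213 n)
av132-213-unique zero    = All.[] AllPairs.∷ AllPairs.[]
av132-213-unique (suc n) =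
  ++⁺ (map⁺ prepend-injective (av132-213-unique n)) (map⁺ prepend-injective (av132-213-unique n))
      max≢head
  where
    max≢head : ∀ {v} → ¬ (v ∈ List.map prependMax (av132-213 n) ×
                          v ∈ List.map prependHead (av132-213 n))
    max≢head (v∈max , v∈head)
      with _ , _ , refl ← ∈-map⁻ prependMax v∈max
      with _ , _ , eq ← ∈-map⁻ prependHead v∈head = Fin.fromℕ≢inject₁ (∷-injectiveˡ eq)

av132-213-length : ∀ n → length (av132-213 n) ≡ 2 ^ n
av132-213-length zero    = refl
av132-213-length (suc n) = begin
  length (List.map prependMax avs ++ List.map prependHead avs)
    ≡⟨ length-++ (List.map prependMax avs) ⟩
  length (List.map prependMax avs) + length (List.map prependHead avs)
    ≡⟨ cong₂ _+_ (length-map prependMax avs) (length-map prependHead avs) ⟩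
  length avs + length avs
    ≡⟨ cong (λ l → l + l) (av132-213-length n) ⟩
  2 ^ n + 2 ^ n
    ≡⟨ cong (2 ^ n +_) (+-identityʳ _) ⟨
  2 ^ suc n
    ∎
  where
    open ≡-Reasoning
    avs = av132-213 n

Av132-213-card : ∀ n → HasCard (Av132-213 {suc n}) (2 ^ n)
Av132-213-card n =
  av132-213 n , av132-213-unique n , av132-213-length n ,
  λ _ → av132-213-sound n , av132-213-complete n

-- Complements

Complementary : ℕ → Triple → Triple → Set
Complementary s ⟨ x , y , z ⟩ ⟨ x' , y' , z' ⟩ = x + x' ≡ s × y + y' ≡ s × z + z' ≡ s

Complementary-sym : ∀ {s} t t' → Complementary s t t' → Complementary s t' t
Complementary-sym ⟨ x , y , z ⟩ ⟨ x' , y' , z' ⟩ (ex , ey , ez) =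
  trans (+-comm x' x) ex , trans (+-comm y' y) ey , trans (+-comm z' z) ez

complement-< : ∀ {s x x' y y'} → x + x' ≡ s → y + y' ≡ s → x < y → y' < x'
complement-< ex ey x<y = ≰⇒> (λ x'≤y' → <-irrefl (trans ex (sym ey)) (+-mono-<-≤ x<y x'≤y'))

complement-<′ : ∀ {s x x' y y'} → x + x' ≡ s → y + y' ≡ s → x' < y' → y < x
complement-<′ {x = x} {x'} {y} {y'} ex ey =
  complement-< (trans (+-comm x' x) ex) (trans (+-comm y' y) ey)

SameOrder-complement : ∀ {s s' a b c a' b' c'} t t' →
                       Complementary s ⟨ a , b , c ⟩ ⟨ a' , b' , c' ⟩ → Complementary s' t t' →
                       SameOrder a b c t → SameOrder a' b' c' t'
SameOrder-complement ⟨ _ , _ , _ ⟩ ⟨ _ , _ , _ ⟩ (ea , eb , ec) (ex , ey , ez)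
                     (ab , xy , ac , xz , bc , yz , ba , yx , ca , zx , cb , zy) =
  complement-< ey ex ∘ ba ∘ complement-<′ ea eb , complement-< eb ea ∘ yx ∘ complement-<′ ex ey ,
  complement-< ez ex ∘ ca ∘ complement-<′ ea ec , complement-< ec ea ∘ zx ∘ complement-<′ ex ez ,
  complement-< ez ey ∘ cb ∘ complement-<′ eb ec , complement-< ec eb ∘ zy ∘ complement-<′ ey ez ,
  complement-< ex ey ∘ ab ∘ complement-<′ eb ea , complement-< ea eb ∘ xy ∘ complement-<′ ey ex ,
  complement-< ex ez ∘ ac ∘ complement-<′ ec ea , complement-< ea ec ∘ xz ∘ complement-<′ ez ex ,
  complement-< ey ez ∘ bc ∘ complement-<′ ec eb , complement-< eb ec ∘ yz ∘ complement-<′ ez ey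

ComplementaryPatterns : Pattern → Pattern → Set
ComplementaryPatterns (first-dash t)  (first-dash t')  = Complementary 4 t t'
ComplementaryPatterns (second-dash t) (second-dash t') = Complementary 4 t t'
ComplementaryPatterns _               _                = ⊥

ComplementaryPatterns-sym : ∀ p p' → ComplementaryPatterns p p' → ComplementaryPatterns p' p
ComplementaryPatterns-sym (first-dash t)  (first-dash t')  = Complementary-sym t t'
ComplementaryPatterns-sym (second-dash t) (second-dash t') = Complementary-sym t t'

toℕ+toℕ-opposite : ∀ {n} (i : Fin n) → toℕ i + toℕ (opposite i) ≡ n ∸ 1
toℕ+toℕ-opposite {suc n} i = trans (cong (toℕ i +_) (opposite-prop i)) (m+[n∸m]≡n (s≤s⁻¹ (toℕ<n i)))

module _ {k} (w : Vec (Fin k) k) where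

  private
    w̄ = map opposite w

    val+val-opposite : ∀ i → val w i + val w̄ i ≡ k ∸ 1
    val+val-opposite i = trans (cong (λ v → val w i + toℕ v) (lookup-map i opposite w))
                               (toℕ+toℕ-opposite (lookup w i))

    complementary-values : ∀ i j l →
      Complementary (k ∸ 1) ⟨ val w i , val w j , val w l ⟩ ⟨ val w̄ i , val w̄ j , val w̄ l ⟩
    complementary-values i j l = val+val-opposite i , val+val-opposite j , val+val-opposite l

  Contains-complement : ∀ p p' → ComplementaryPatterns p p' →
                        Contains p w → Contains p' (map opposite w)
  Contains-complement (first-dash t) (first-dash t') t~t' (i , j , j' , i<j , j'≡1+j , so) =
    i , j , j' , i<j , j'≡1+j , SameOrder-complement t t' (complementary-values i j j') t~t' so
  Contains-complement (second-dash t) (second-dash t') t~t' (i , i' , m , i'≡1+i , 1+i<m , so) =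
    i , i' , m , i'≡1+i , 1+i<m , SameOrder-complement t t' (complementary-values i i' m) t~t' so

map-opposite-involutive : ∀ {n k} (w : Vec (Fin n) k) → map opposite (map opposite w) ≡ w
map-opposite-involutive w =
  trans (sym (map-∘ opposite opposite w)) (trans (map-cong opposite-involutive w) (map-id w))

IsPerm-opposite : ∀ {k} (w : Vec (Fin k) k) → IsPerm w → IsPerm (map opposite w)
IsPerm-opposite w perm {i} {j} e = perm (begin
  lookup w i                       ≡⟨ opposite-involutive _ ⟨
  opposite (opposite (lookup w i)) ≡⟨ cong opposite (trans (sym (lookup-map i opposite w))
                                                           (trans e (lookup-map j opposite w))) ⟩
  opposite (opposite (lookup w j)) ≡⟨ opposite-involutive _ ⟩
  lookup w j                       ∎)
  where open ≡-Reasoning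

InS-complement : ∀ {k p q p' q'} {w : Vec (Fin k) k} →
                 ComplementaryPatterns p p' → ComplementaryPatterns q q' →
                 InS k p q w → InS k p' q' (map opposite w)
InS-complement {p = p} {q} {p'} {q'} {w} p~p' q~q' (perm , ¬p , ¬q) =
  IsPerm-opposite w perm , ¬p ∘ back p p' p~p' , ¬q ∘ back q q' q~q'
  where
    back : ∀ r r' → ComplementaryPatterns r r' → Contains r' (map opposite w) → Contains r w
    back r r' r~r' = subst (Contains r) (map-opposite-involutive w)
                   ∘ Contains-complement (map opposite w) r' r (ComplementaryPatterns-sym r r' r~r')

module _ {n m : ℕ} {P Q : Vec (Fin n) n → Set} where

  HasCard-involution : (f : Vec (Fin n) n → Vec (Fin n) n) → (∀ w → f (f w) ≡ w) →
                       (∀ {w} → P w → Q (f w)) → (∀ {w} → Q w → P (f w)) → HasCard P m → HasCard Q m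
  HasCard-involution f f∘f≡id P⇒Q∘f Q⇒P∘f (ws , unique , length≡m , ∈ws⇔P) =
    List.map f ws , map⁺ f-injective unique , trans (length-map f ws) length≡m ,
    λ _ → sound , complete
    where
      f-injective : ∀ {v w} → f v ≡ f w → v ≡ w
      f-injective {v} {w} e = trans (sym (f∘f≡id v)) (trans (cong f e) (f∘f≡id w))
      sound : ∀ {w} → w ∈ List.map f ws → Q w
      sound w∈ with v , v∈ws , refl ← ∈-map⁻ f w∈ = P⇒Q∘f (proj₁ (∈ws⇔P v) v∈ws)
      complete : ∀ {w} → Q w → w ∈ List.map f ws
      complete {w} q =
        subst (_∈ List.map f ws) (f∘f≡id w) (∈-map⁺ f (proj₂ (∈ws⇔P (f w)) (Q⇒P∘f q)))

  HasCard-⇔ : (∀ {w} → P w ⇔ Q w) → HasCard P m → HasCard Q m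
  HasCard-⇔ P⇔Q = HasCard-involution id (λ _ → refl) (Equivalence.to P⇔Q) (Equivalence.from P⇔Q)

HasCard-complement : ∀ {k m} p q p' q' → ComplementaryPatterns p p' → ComplementaryPatterns q q' →
                     HasCard (InS k p q) m → HasCard (InS k p' q') m
HasCard-complement p q p' q' p~p' q~q' = HasCard-involution (map opposite) map-opposite-involutive
  (InS-complement {p = p} {q} {p'} {q'} p~p' q~q')
  (InS-complement {p = p'} {q'} {p} {q} (ComplementaryPatterns-sym p p' p~p')
                                         (ComplementaryPatterns-sym q q' q~q'))

mainTheorem7 : (n : ℕ) → 1 ≤ n →
    HasCard (InS n (first-dash ⟨ 1 , 3 , 2 ⟩) (first-dash ⟨ 2 , 1 , 3 ⟩)) (2 ^ (n ∸ 1)) ×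
    HasCard (InS n (first-dash ⟨ 3 , 1 , 2 ⟩) (first-dash ⟨ 2 , 3 , 1 ⟩)) (2 ^ (n ∸ 1)) ×
    HasCard (InS n (second-dash ⟨ 1 , 3 , 2 ⟩) (second-dash ⟨ 2 , 1 , 3 ⟩)) (2 ^ (n ∸ 1)) ×
    HasCard (InS n (second-dash ⟨ 2 , 3 , 1 ⟩) (second-dash ⟨ 3 , 1 , 2 ⟩)) (2 ^ (n ∸ 1))
mainTheorem7 (suc n) _ =
  S[1-32,2-13] ,
  HasCard-complement (first-dash ⟨ 1 , 3 , 2 ⟩) (first-dash ⟨ 2 , 1 , 3 ⟩)
                     (first-dash ⟨ 3 , 1 , 2 ⟩) (first-dash ⟨ 2 , 3 , 1 ⟩)
                     (refl , refl , refl) (refl , refl , refl) S[1-32,2-13] ,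
  S[13-2,21-3] ,
  HasCard-complement (second-dash ⟨ 2 , 1 , 3 ⟩) (second-dash ⟨ 1 , 3 , 2 ⟩)
                     (second-dash ⟨ 2 , 3 , 1 ⟩) (second-dash ⟨ 3 , 1 , 2 ⟩)
                     (refl , refl , refl) (refl , refl , refl) S[21-3,13-2]
  where
    S[1-32,2-13] : HasCard (InS (suc n) (first-dash ⟨ 1 , 3 , 2 ⟩) (first-dash ⟨ 2 , 1 , 3 ⟩)) (2 ^ n)
    S[1-32,2-13] = HasCard-⇔ (λ {w} → Av132-213⇔avoidsFirstDash w) (Av132-213-card n)
    S[13-2,21-3] : HasCard (InS (suc n) (second-dash ⟨ 1 , 3 , 2 ⟩) (second-dash ⟨ 2 , 1 , 3 ⟩)) (2 ^ n)
    S[13-2,21-3] = HasCard-⇔ (λ {w} → Av132-213⇔avoidsSecondDash w) (Av132-213-card n)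
    S[21-3,13-2] : HasCard (InS (suc n) (second-dash ⟨ 2 , 1 , 3 ⟩) (second-dash ⟨ 1 , 3 , 2 ⟩)) (2 ^ n)
    S[21-3,13-2] = HasCard-⇔ (mk⇔ (map₂ swap) (map₂ swap)) S[13-2,21-3]
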